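{- Let $n\geq 4$. The initial cost cop product throttling number of the cycle $C_n$ is $$\operatorname{th}_c^\times(C_n)=\begin{cases}3\left(1+\left\lceil\frac{n-3}{6}\right\rceil\right) & \text{if } n=12i+3 \text{ for some integer } i\geq 1,\\[2pt] 2\left(1+\left\lceil\frac{n-2}{4}\right\rceil\right) & \text{otherwise.}\end{cases}$$
   Context: Cops and Robbers on a graph $G$: cops are placed on the vertices of an initial set $S\subseteq V(G)$, then a robber is placed on a vertex; the players then alternate, in each round every cop moves to an adjacent vertex or stays, then the robber moves to an adjacent vertex or stays. The cops win when some cop occupies the robber's vertex. The cop number $c(G)$ is the minimum number of cops that can guarantee capture. The capture time $\mathrm{capt}(G;S)$ is the minimum number of rounds for cops starting on $S$ to capture the robber under optimal play of both players ($\infty$ if capture cannot be guaranteed), and $\mathrm{capt}_k(G)=\min\{\mathrm{capt}(G;S):|S|=k\}$. The initial cost cop product throttling number is $\operatorname{th}_c^\times(G)=\min\{k(1+\mathrm{capt}_k(G)): k\geq c(G)\}$. $C_n$ is the cycle on $n$ vertices. -}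

module Defs where

open import Data.Nat using (ℕ; zero; suc; _+_; _*_; _∸_; _≤_; _/_; _%_)
open import Data.Fin using (Fin; toℕ)
open import Data.Product using (Σ; ∃; _×_; _,_)
open import Data.Sum using (_⊎_)
open import Relation.Binary.PropositionalEquality using (_≡_)
open import Function.Definitions using (Injective)

record Graph : Set₁ where
  field
    order : ℕ
    Adj   : Fin order → Fin order → Set

open Graph public

CycSucc : (n : ℕ) → Fin n → Fin n → Set
CycSucc n i j = (toℕ j ≡ suc (toℕ i)) ⊎ (suc (toℕ i) ≡ n × toℕ j ≡ 0)

Cycle : ℕ → Graph
Cycle n = record
  { order = n
  ; Adj   = λ i j → CycSucc n i j ⊎ CycSucc n j i
  }

module _ (G : Graph) where
  V : Set
  V = Fin (order G)

  Move : V → V → Set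
  Move u v = u ≡ v ⊎ Adj G u v

  Cops : ℕ → Set
  Cops k = Fin k → V

  Caught : ∀ {k} → Cops k → V → Set
  Caught c r = ∃ λ i → c i ≡ r

  CopStep : ∀ {k} → Cops k → Cops k → Set
  CopStep c c' = ∀ i → Move (c i) (c' i)

  -- Win t c r : with cops at c and robber at r (cops to move next),
  -- the cops can force capture within t more rounds.
  Win : ℕ → ∀ {k} → Cops k → V → Set
  Win zero    c r = Caught c r
  Win (suc t) c r = Caught c r ⊎
    Σ (Cops _) λ c' → CopStep c c' ×
      (Caught c' r ⊎ (∀ r' → Move r r' → Win t c' r'))

  -- An initial set S ⊆ V(G) with |S| = k is given as an injective map Fin k → V
  -- (its image is S).
  InitialSet : ℕ → Set
  InitialSet k = Σ (Cops k) λ S → Injective _≡_ _≡_ S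

  CapturesWithin : ∀ {k} → Cops k → ℕ → Set
  CapturesWithin S t = ∀ r → Win t S r

  IsCapt : ∀ {k} → Cops k → ℕ → Set
  IsCapt S t = CapturesWithin S t × (∀ t' → CapturesWithin S t' → t ≤ t')

  IsCaptK : ℕ → ℕ → Set
  IsCaptK k t =
    (Σ (InitialSet k) λ S → IsCapt (Data.Product.proj₁ S) t) ×
    (∀ (S : InitialSet k) t' → IsCapt (Data.Product.proj₁ S) t' → t ≤ t')

  IsCopNumber : ℕ → Set
  IsCopNumber c =
    (Σ (InitialSet c) λ S → ∃ λ t → CapturesWithin (Data.Product.proj₁ S) t) ×
    (∀ k (S : InitialSet k) t → CapturesWithin (Data.Product.proj₁ S) t → c ≤ k)

  -- th_c^×(G) = m : minimum of k(1 + capt_k(G)) over k ≥ c(G)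
  -- (terms with capt_k(G) = ∞ do not contribute to the minimum)
  IsThrottlingNumber : ℕ → Set
  IsThrottlingNumber m = Σ ℕ λ c → IsCopNumber c ×
    ((Σ ℕ λ k → Σ ℕ λ t → c ≤ k × IsCaptK k t × m ≡ k * (1 + t)) ×
     (∀ k t → c ≤ k → IsCaptK k t → m ≤ k * (1 + t)))

⌈_/_⌉ : ℕ → (b : ℕ) → ℕ
⌈ a / zero ⌉ = 0
⌈ a / suc b ⌉ = (a + b) / suc b

{-# OPTIONS --safe #-}

-- Against a robber who never moves, cops that capture within t rounds must have walked to him,
-- and on C_n a cop reaches at most 2t + 1 vertices in t moves; so k cops with capture time t
-- need n ≤ k(2t + 1). Conversely, two cops at the ends of an arc of length at most 2t + 1 walk
-- towards each other and trap a robber inside within t rounds, so cops spaced at most 2t + 1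
-- apart capture within t rounds, while a single cop is evaded by a robber keeping distance two:
-- c(C_n) = 2. Minimising k(1 + t) subject to n ≤ k(2t + 1): two cops give 2(1 + ⌈(n − 2)/4⌉),
-- four or more never do better, and three do better exactly when n = 12i + 3.

module Submission where

open import Defs
open import Data.Nat using (ℕ; zero; suc; _+_; _*_; _∸_; _≤_; _<_; _%_; z≤n; s≤s; s≤s⁻¹; _<?_; _≤?_)
open import Data.Nat.Properties
open import Data.Nat.DivMod
open import Data.Nat.Tactic.RingSolver using (solve-∀)
open import Algebra.Properties.CommutativeSemigroup +-commutativeSemigroup using (x∙yz≈y∙xz)
open import Data.Fin using (Fin; toℕ; fromℕ<; combine) renaming (zero to fzero; suc to fsuc)
open import Data.Fin.Properties
  using (toℕ-injective; toℕ<n; toℕ-fromℕ<; combine-injective; injective⇒≤)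
  renaming (_≟_ to _≟ᶠ_)
open import Data.Vec.Functional using (updateAt; _∷_; [])
open import Data.Vec.Functional.Properties using (updateAt-updates; updateAt-minimal)
open import Data.Product using (Σ; ∃; ∃₂; _×_; _,_; proj₁; proj₂)
open import Data.Sum using (_⊎_; inj₁; inj₂)
open import Data.Empty using (⊥-elim)
open import Function using (_∘_; const; case_of_)
open import Function.Definitions using (Injective)
open import Relation.Nullary using (¬_; yes; no)
open import Relation.Binary.PropositionalEquality

module Game (G : Graph) where

  Reach : ℕ → V G → V G → Set
  Reach zero    u r = u ≡ r
  Reach (suc t) u r = ∃ λ v → Move G u v × Reach t v r

  reach-stay : ∀ t u → Reach t u u
  reach-stay zero    u = refl
  reach-stay (suc t) u = u , inj₁ refl , reach-stay t u

  RobberToMove : ℕ → ∀ {k} → Cops G k → V G → Set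
  RobberToMove t c r = Caught G c r ⊎ (∀ r' → Move G r r' → Win G t c r')

  caught⇒win : ∀ t {k} {c : Cops G k} {r} → Caught G c r → Win G t c r
  caught⇒win zero    caught = caught
  caught⇒win (suc t) caught = inj₁ caught

  win⇒reach : ∀ t {k} (c : Cops G k) r → Win G t c r → ∃ λ i → Reach t (c i) r
  win⇒reach zero    c r caught = caught
  win⇒reach (suc t) c r (inj₁ (i , refl)) = i , reach-stay (suc t) r
  win⇒reach (suc t) c r (inj₂ (c' , step , inj₁ (i , refl))) = i , r , step i , reach-stay t r
  win⇒reach (suc t) c r (inj₂ (c' , step , inj₂ respond))
    with i , reach ← win⇒reach t c' r (respond r (inj₁ refl)) = i , c' i , step i , reach

  copStep-stay : ∀ {k} (c : Cops G k) → CopStep G c c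
  copStep-stay c i = inj₁ refl

  copStep-updateAt : ∀ {k} {c d : Cops G k} {j b} →
                     CopStep G c d → Move G (c j) b → CopStep G c (updateAt d j (const b))
  copStep-updateAt {c = c} {d} {j} step move i with i ≟ᶠ j
  ... | yes refl = subst (Move G (c i)) (sym (updateAt-updates i d)) move
  ... | no i≢j   = subst (Move G (c i)) (sym (updateAt-minimal i j d i≢j)) (step i)

  module _ (Necessary : ℕ → ℕ → Set)
           (necessary : ∀ {k} (S : Cops G k) t → CapturesWithin G S t → Necessary k t) where

    isCaptK-intro : ∀ {k t} (S : InitialSet G k) → CapturesWithin G (proj₁ S) t →
                    (∀ t' → Necessary k t' → t ≤ t') → IsCaptK G k t
    isCaptK-intro S capture least =
      (S , capture , λ t' capture' → least t' (necessary _ t' capture')) ,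
      λ S' t' capt' → least t' (necessary _ t' (proj₁ capt'))

    isThrottlingNumber-intro :
      ∀ {c k t m} → IsCopNumber G c → c ≤ k →
      (S : InitialSet G k) → CapturesWithin G (proj₁ S) t → (∀ t' → Necessary k t' → t ≤ t') →
      m ≡ k * (1 + t) → (∀ k' t' → c ≤ k' → Necessary k' t' → m ≤ k' * (1 + t')) →
      IsThrottlingNumber G m
    isThrottlingNumber-intro {c} {k} {t} copNumber c≤k S capture least m≡ lower =
      c , copNumber , (k , t , c≤k , isCaptK-intro S capture least , m≡) ,
      λ k' t' c≤k' ((S' , capt') , _) → lower k' t' c≤k' (necessary _ t' (proj₁ capt'))

Exceptional : ℕ → Set
Exceptional n = Σ ℕ λ i → 1 ≤ i × n ≡ 12 * i + 3

⌈a/1+b⌉*[1+b]≤a+b : ∀ a b → ⌈ a / suc b ⌉ * suc b ≤ a + b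
⌈a/1+b⌉*[1+b]≤a+b a b = m/n*n≤m (a + b) (suc b)

a≤⌈a/1+b⌉*[1+b] : ∀ a b → a ≤ ⌈ a / suc b ⌉ * suc b
a≤⌈a/1+b⌉*[1+b] a b = +-cancelʳ-≤ b a (q * suc b) (begin
  a + b                       ≡⟨ m≡m%n+[m/n]*n (a + b) (suc b) ⟩
  (a + b) % suc b + q * suc b ≤⟨ +-monoˡ-≤ (q * suc b) (s≤s⁻¹ (m%n<n (a + b) (suc b))) ⟩
  b + q * suc b               ≡⟨ +-comm b (q * suc b) ⟩
  q * suc b + b               ∎)
  where
    open ≤-Reasoning
    q : ℕ
    q = ⌈ a / suc b ⌉

⌈m*[1+b]/[1+b]⌉≡m : ∀ m b → ⌈ m * suc b / suc b ⌉ ≡ m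
⌈m*[1+b]/[1+b]⌉≡m m b = ≤-antisym
  (s≤s⁻¹ (*-cancelʳ-< (suc b) _ (suc m) (begin-strict
    ⌈ m * suc b / suc b ⌉ * suc b  ≤⟨ ⌈a/1+b⌉*[1+b]≤a+b (m * suc b) b ⟩
    m * suc b + b                  <⟨ +-monoʳ-< (m * suc b) (n<1+n b) ⟩
    m * suc b + suc b              ≡⟨ +-comm (m * suc b) (suc b) ⟩
    suc m * suc b                  ∎)))
  (*-cancelʳ-≤ m _ (suc b) (a≤⌈a/1+b⌉*[1+b] (m * suc b) b))
  where open ≤-Reasoning

2*m≤1+2*n⇒m≤n : ∀ {m n} → 2 * m ≤ suc (2 * n) → m ≤ n
2*m≤1+2*n⇒m≤n {m} {n} le =
  s≤s⁻¹ (*-cancelˡ-< 2 m (suc n) (subst (2 * m <_) (sym (*-suc 2 n)) (s≤s le)))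

2*m≡n+2*o⇒n≡2*[m∸o] : ∀ {m n o} → 2 * m ≡ n + 2 * o → n ≡ 2 * (m ∸ o)
2*m≡n+2*o⇒n≡2*[m∸o] {m} {n} {o} eq = sym (begin
  2 * (m ∸ o)        ≡⟨ *-distribˡ-∸ 2 m o ⟩
  2 * m ∸ 2 * o      ≡⟨ cong (_∸ 2 * o) eq ⟩
  n + 2 * o ∸ 2 * o  ≡⟨ m+n∸n≡m n (2 * o) ⟩
  n                  ∎)
  where open ≡-Reasoning

-- Since k(1 + t) is half of k(2t + 1) + k, the covering bound N ≤ k(2t + 1) bounds k(1 + t).
throttling-bound : ∀ {N m j k t} → 2 * m ≤ suc (N + j) → j ≤ k → N ≤ k * suc (2 * t) →
                   m ≤ k * (1 + t)
throttling-bound {N} {m} {j} {k} {t} 2m≤ j≤k N≤ = 2*m≤1+2*n⇒m≤n (begin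
  2 * m                       ≤⟨ 2m≤ ⟩
  suc (N + j)                 ≤⟨ s≤s (+-mono-≤ N≤ j≤k) ⟩
  suc (k * suc (2 * t) + k)   ≡⟨ cong suc (halves k t) ⟩
  suc (2 * (k * (1 + t)))     ∎)
  where
    open ≤-Reasoning
    halves : ∀ k t → k * suc (2 * t) + k ≡ 2 * (k * (1 + t))
    halves = solve-∀

module NormalCase {N T : ℕ} (4≤N : 4 ≤ N) (T*4≤N+1 : T * 4 ≤ N + 1) where
  open ≤-Reasoning

  T≤t : ∀ {t} → N ≤ 2 * suc (2 * t) → T ≤ t
  T≤t {t} N≤ = 2*m≤1+2*n⇒m≤n (2*m≤1+2*n⇒m≤n (begin
    2 * (2 * T)            ≡⟨ quadruple T ⟩
    T * 4                  ≤⟨ T*4≤N+1 ⟩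
    N + 1                  ≤⟨ +-monoˡ-≤ 1 N≤ ⟩
    2 * suc (2 * t) + 1    ≡⟨ +-comm _ 1 ⟩
    suc (2 * suc (2 * t))  ∎))
    where
      quadruple : ∀ T → 2 * (2 * T) ≡ T * 4
      quadruple = solve-∀

  2*[2*[1+T]]≤N+5 : 2 * (2 * (1 + T)) ≤ suc (N + 4)
  2*[2*[1+T]]≤N+5 = begin
    2 * (2 * (1 + T))  ≡⟨ expand T ⟩
    T * 4 + 4          ≤⟨ +-monoˡ-≤ 4 T*4≤N+1 ⟩
    N + 1 + 4          ≡⟨ regroup N ⟩
    suc (N + 4)        ∎
    where
      expand : ∀ T → 2 * (2 * (1 + T)) ≡ T * 4 + 4
      expand = solve-∀
      regroup : ∀ N → N + 1 + 4 ≡ suc (N + 4)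
      regroup = solve-∀

  2+2T≤N : 2 + 2 * T ≤ N
  2+2T≤N = 2*m≤1+2*n⇒m≤n (begin
    2 * (2 + 2 * T)    ≡⟨ cong (2 *_) (sym (*-distribˡ-+ 2 1 T)) ⟩
    2 * (2 * (1 + T))  ≤⟨ 2*[2*[1+T]]≤N+5 ⟩
    suc (N + 4)        ≤⟨ s≤s (+-monoʳ-≤ N (≤-trans 4≤N (≤-reflexive (sym (+-identityʳ N))))) ⟩
    suc (2 * N)        ∎)

  -- Three cops beat two only when 4(1 + T) = N + 5 = 6t + 8, which forces t to be even
  -- and N = 12i + 3.
  three-cops-faster⇒exceptional : ∀ {t} → N ≤ 3 * suc (2 * t) → 3 * (1 + t) < 2 * (1 + T) →
                                  Exceptional N
  three-cops-faster⇒exceptional {t} N≤ faster = i , 1≤i , N≡12i+3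
    where
      three-cops : ℕ
      three-cops = 2 * suc (3 * (1 + t))

      three-cops≡ : three-cops ≡ suc (3 * suc (2 * t) + 4)
      three-cops≡ = e t
        where
          e : ∀ t → 2 * suc (3 * (1 + t)) ≡ suc (3 * suc (2 * t) + 4)
          e = solve-∀

      2*[2*[1+T]]≡three-cops : 2 * (2 * (1 + T)) ≡ three-cops
      2*[2*[1+T]]≡three-cops = ≤-antisym
        (≤-trans 2*[2*[1+T]]≤N+5 (≤-trans (s≤s (+-monoˡ-≤ 4 N≤)) (≤-reflexive (sym three-cops≡))))
        (*-monoʳ-≤ 2 faster)

      N≡3[1+2t] : N ≡ 3 * suc (2 * t)
      N≡3[1+2t] = ≤-antisym N≤ (+-cancelʳ-≤ 4 _ _ (s≤s⁻¹ (begin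
        suc (3 * suc (2 * t) + 4)  ≡⟨ three-cops≡ ⟨
        three-cops                 ≡⟨ 2*[2*[1+T]]≡three-cops ⟨
        2 * (2 * (1 + T))          ≤⟨ 2*[2*[1+T]]≤N+5 ⟩
        suc (N + 4)                ∎)))

      2T≡t+2[1+t] : 2 * T ≡ t + 2 * suc t
      2T≡t+2[1+t] = +-cancelˡ-≡ 2 _ _ (begin-equality
        2 + 2 * T            ≡⟨ *-distribˡ-+ 2 1 T ⟨
        2 * (1 + T)          ≡⟨ *-cancelˡ-≡ _ _ 2 2*[2*[1+T]]≡three-cops ⟩
        suc (3 * (1 + t))    ≡⟨ e t ⟩
        2 + (t + 2 * suc t)  ∎)
        where
          e : ∀ t → suc (3 * (1 + t)) ≡ 2 + (t + 2 * suc t)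
          e = solve-∀

      i : ℕ
      i = T ∸ suc t

      t≡2i : t ≡ 2 * i
      t≡2i = 2*m≡n+2*o⇒n≡2*[m∸o] {T} {t} {suc t} 2T≡t+2[1+t]

      N≡12i+3 : N ≡ 12 * i + 3
      N≡12i+3 = trans N≡3[1+2t] (trans (cong (λ t → 3 * suc (2 * t)) t≡2i) (e i))
        where
          e : ∀ i → 3 * suc (2 * (2 * i)) ≡ 12 * i + 3
          e = solve-∀

      1≤i : 1 ≤ i
      1≤i = n≢0⇒n>0 λ i≡0 →
        <⇒≢ 4≤N (sym (trans N≡12i+3 (cong (λ i → 12 * i + 3) i≡0)))

  2*[1+T]≤k*[1+t] : ¬ Exceptional N → ∀ {k t} → 2 ≤ k → N ≤ k * suc (2 * t) →
                    2 * (1 + T) ≤ k * (1 + t)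
  2*[1+T]≤k*[1+t] regular {1} (s≤s ()) _
  2*[1+T]≤k*[1+t] regular {2} _ N≤ = *-monoʳ-≤ 2 (s≤s (T≤t N≤))
  2*[1+T]≤k*[1+t] regular {3} {t} _ N≤ with 2 * (1 + T) ≤? 3 * (1 + t)
  ... | yes le = le
  ... | no  ≰  = ⊥-elim (regular (three-cops-faster⇒exceptional N≤ (≰⇒> ≰)))
  2*[1+T]≤k*[1+t] regular {k@(suc (suc (suc (suc _))))} _ N≤ =
    throttling-bound {k = k} 2*[2*[1+T]]≤N+5 (s≤s (s≤s (s≤s (s≤s z≤n)))) N≤

module ExceptionalCase {N i : ℕ} (N≡12i+3 : N ≡ 12 * i + 3) where

  2i≤t : ∀ {t} → N ≤ 3 * suc (2 * t) → 2 * i ≤ t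
  2i≤t {t} N≤ = *-cancelʳ-≤ (2 * i) t 6 (+-cancelʳ-≤ 3 _ _ (begin
    2 * i * 6 + 3     ≡⟨ e₁ i ⟩
    12 * i + 3        ≡⟨ N≡12i+3 ⟨
    N                 ≤⟨ N≤ ⟩
    3 * suc (2 * t)   ≡⟨ e₂ t ⟩
    t * 6 + 3         ∎))
    where
      open ≤-Reasoning
      e₁ : ∀ i → 2 * i * 6 + 3 ≡ 12 * i + 3
      e₁ = solve-∀
      e₂ : ∀ t → 3 * suc (2 * t) ≡ t * 6 + 3
      e₂ = solve-∀

  3*[1+2i]≤k*[1+t] : ∀ {k t} → 2 ≤ k → N ≤ k * suc (2 * t) → 3 * (1 + 2 * i) ≤ k * (1 + t)
  3*[1+2i]≤k*[1+t] 2≤k N≤ =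
    throttling-bound (≤-reflexive (trans (e i) (cong (λ n → suc (n + 2)) (sym N≡12i+3)))) 2≤k N≤
    where
      e : ∀ i → 2 * (3 * (1 + 2 * i)) ≡ suc (12 * i + 3 + 2)
      e = solve-∀

  ⌈N∸3/6⌉≡2i : ⌈ N ∸ 3 / 6 ⌉ ≡ 2 * i
  ⌈N∸3/6⌉≡2i = trans (cong (λ a → ⌈ a / 6 ⌉) N∸3≡2i*6) (⌈m*[1+b]/[1+b]⌉≡m (2 * i) 5)
    where
      N∸3≡2i*6 : N ∸ 3 ≡ 2 * i * 6
      N∸3≡2i*6 = trans (cong (_∸ 3) N≡12i+3) (trans (m+n∸n≡m (12 * i) 3) (e i))
        where
          e : ∀ i → 12 * i ≡ 2 * i * 6
          e = solve-∀

data ArcPoint : ℕ → ℕ → Set where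
  left-end  : ∀ {L} → ArcPoint 0 L
  right-end : ∀ {L} → ArcPoint L L
  interior  : ∀ {d L} → d ≤ L → ArcPoint (suc d) (2 + L)

arcPoint : ∀ {d L} → d ≤ L → ArcPoint d L
arcPoint {zero}  _         = left-end
arcPoint {suc d} (s≤s d≤L) with m≤n⇒m<n∨m≡n d≤L
... | inj₁ (s≤s d≤L') = interior d≤L'
... | inj₂ refl       = right-end

2+L≤1+2[1+t]⇒L≤1+2t : ∀ {L t} → 2 + L ≤ suc (2 * suc t) → L ≤ suc (2 * t)
2+L≤1+2[1+t]⇒L≤1+2t {L} {t} le = s≤s⁻¹ (s≤s⁻¹ (subst (2 + L ≤_) (cong suc (*-suc 2 t)) le))

module OnCycle (n' : ℕ) where

  N : ℕ
  N = suc n'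

  open Game (Cycle N)

  vertex : ℕ → Fin N
  vertex x = fromℕ< (m%n<n x N)

  toℕ-vertex : ∀ x → toℕ (vertex x) ≡ x % N
  toℕ-vertex x = toℕ-fromℕ< (m%n<n x N)

  vertex-cong : ∀ x y → x % N ≡ y % N → vertex x ≡ vertex y
  vertex-cong x y eq = toℕ-injective (trans (toℕ-vertex x) (trans eq (sym (toℕ-vertex y))))

  vertex-N+ : ∀ x → vertex (N + x) ≡ vertex x
  vertex-N+ x = vertex-cong (N + x) x (trans (cong (_% N) (+-comm N x)) ([m+n]%n≡m%n x N))

  vertex-+*N : ∀ x t → vertex (x + t * N) ≡ vertex x
  vertex-+*N x t = vertex-cong (x + t * N) x ([m+kn]%n≡m%n x t N)

  toℕ-vertex-< : ∀ {x} → x < N → toℕ (vertex x) ≡ x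
  toℕ-vertex-< {x} x<N = trans (toℕ-vertex x) (m<n⇒m%n≡m x<N)

  vertex-toℕ : ∀ u → vertex (toℕ u) ≡ u
  vertex-toℕ u = toℕ-injective (toℕ-vertex-< (toℕ<n u))

  vertex-injective-< : ∀ {x y} → x < N → y < N → vertex x ≡ vertex y → x ≡ y
  vertex-injective-< x<N y<N eq =
    trans (sym (toℕ-vertex-< x<N)) (trans (cong toℕ eq) (toℕ-vertex-< y<N))

  vertex-+toℕ : ∀ y x → vertex (y + toℕ (vertex x)) ≡ vertex (y + x)
  vertex-+toℕ y x = vertex-cong (y + toℕ (vertex x)) (y + x) (begin
    (y + toℕ (vertex x)) % N     ≡⟨ cong (λ z → (y + z) % N) (toℕ-vertex x) ⟩
    (y + x % N) % N              ≡⟨ %-distribˡ-+ y (x % N) N ⟩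
    (y % N + x % N % N) % N      ≡⟨ cong (λ z → (y % N + z) % N) (m%n%n≡m%n x N) ⟩
    (y % N + x % N) % N          ≡⟨ %-distribˡ-+ y x N ⟨
    (y + x) % N                  ∎)
    where open ≡-Reasoning

  vertex-≢ : ∀ x {e} → 0 < e → e < N → vertex x ≢ vertex (e + x)
  vertex-≢ x {e} 0<e e<N eq = below-N (toℕ<n (vertex x))
    (trans (vertex-toℕ (vertex x)) (trans eq (sym (vertex-+toℕ e x))))
    where
      below-N : ∀ {s} → s < N → vertex s ≢ vertex (e + s)
      below-N {s} s<N eq with e + s <? N
      ... | yes e+s<N = <-irrefl (vertex-injective-< s<N e+s<N eq) (m<n+m s 0<e)
      ... | no e+s≮N with w , N+w≡e+s ← m≤n⇒∃[o]m+o≡n (≮⇒≥ e+s≮N) =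
        <-irrefl (+-cancelʳ-≡ s e N (trans (sym N+w≡e+s) (cong (N +_) (sym s≡w)))) e<N
        where
          w<N : w < N
          w<N = +-cancelˡ-< N w N (subst (_< N + N) (sym N+w≡e+s) (+-mono-< e<N s<N))
          s≡w : s ≡ w
          s≡w = vertex-injective-< s<N w<N
                  (trans eq (trans (cong vertex (sym N+w≡e+s)) (vertex-N+ w)))

  cycSucc-toℕ : ∀ u → CycSucc N u (vertex (suc (toℕ u)))
  cycSucc-toℕ u with m≤n⇒m<n∨m≡n (toℕ<n u)
  ... | inj₁ 1+u<N = inj₁ (toℕ-vertex-< 1+u<N)
  ... | inj₂ 1+u≡N = inj₂ (1+u≡N , trans (toℕ-vertex (suc (toℕ u)))
                                       (trans (cong (_% N) 1+u≡N) (n%n≡0 N)))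

  cycSucc-vertex : ∀ x → CycSucc N (vertex x) (vertex (suc x))
  cycSucc-vertex x = subst (CycSucc N (vertex x)) (vertex-+toℕ 1 x) (cycSucc-toℕ (vertex x))

  cycSucc-functional : ∀ {u v w} → CycSucc N u v → CycSucc N u w → v ≡ w
  cycSucc-functional (inj₁ v≡1+u) (inj₁ w≡1+u) = toℕ-injective (trans v≡1+u (sym w≡1+u))
  cycSucc-functional {v = v} (inj₁ v≡1+u) (inj₂ (1+u≡N , _)) =
    ⊥-elim (<-irrefl (trans v≡1+u 1+u≡N) (toℕ<n v))
  cycSucc-functional {w = w} (inj₂ (1+u≡N , _)) (inj₁ w≡1+u) =
    ⊥-elim (<-irrefl (trans w≡1+u 1+u≡N) (toℕ<n w))
  cycSucc-functional (inj₂ (_ , v≡0)) (inj₂ (_ , w≡0)) = toℕ-injective (trans v≡0 (sym w≡0))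

  cycSucc-injective : ∀ {u v w} → CycSucc N v u → CycSucc N w u → v ≡ w
  cycSucc-injective (inj₁ u≡1+v) (inj₁ u≡1+w) =
    toℕ-injective (suc-injective (trans (sym u≡1+v) u≡1+w))
  cycSucc-injective (inj₁ u≡1+v) (inj₂ (_ , u≡0)) with () ← trans (sym u≡1+v) u≡0
  cycSucc-injective (inj₂ (_ , u≡0)) (inj₁ u≡1+w) with () ← trans (sym u≡1+w) u≡0
  cycSucc-injective (inj₂ (1+v≡N , _)) (inj₂ (1+w≡N , _)) =
    toℕ-injective (suc-injective (trans 1+v≡N (sym 1+w≡N)))

  -- δ = 0, 1, 2: back, stay, forward.
  move⇒step : ∀ x {v} → Move (Cycle N) (vertex (suc x)) v → ∃ λ δ → δ ≤ 2 × v ≡ vertex (δ + x)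
  move⇒step x (inj₁ refl)        = 1 , s≤s z≤n , refl
  move⇒step x (inj₂ (inj₁ next)) = 2 , ≤-refl , cycSucc-functional next (cycSucc-vertex (suc x))
  move⇒step x (inj₂ (inj₂ prev)) = 0 , z≤n , cycSucc-injective prev (cycSucc-vertex x)

  step⇒move : ∀ x {δ} → δ ≤ 2 → Move (Cycle N) (vertex (suc x)) (vertex (δ + x))
  step⇒move x z≤n             = inj₂ (inj₂ (cycSucc-vertex x))
  step⇒move x (s≤s z≤n)       = inj₁ refl
  step⇒move x (s≤s (s≤s z≤n)) = inj₂ (inj₁ (cycSucc-vertex (suc x)))

  reach⇒near : ∀ t x {r} → Reach t (vertex (t + x)) r → ∃ λ j → j ≤ 2 * t × r ≡ vertex (j + x)
  reach⇒near zero    x refl = 0 , z≤n , refl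
  reach⇒near (suc t) x {r} (v , move , reach)
    with δ , δ≤2 , refl ← move⇒step (t + x) move
    with j , j≤2t , refl ← reach⇒near t (δ + x) (subst (λ y → Reach t (vertex y) r) (x∙yz≈y∙xz δ t x) reach)
    = j + δ , subst (j + δ ≤_) (sym (trans (*-suc 2 t) (+-comm 2 (2 * t)))) (+-mono-≤ j≤2t δ≤2)
            , cong vertex (sym (+-assoc j δ x))

  capturesWithin⇒N≤k*[1+2t] : ∀ {k} (S : Cops (Cycle N) k) t →
                               CapturesWithin (Cycle N) S t → N ≤ k * suc (2 * t)
  capturesWithin⇒N≤k*[1+2t] {k} S t capture = injective⇒≤ code-injective
    where
      base : Fin k → ℕ
      base i = toℕ (S i) + t * n'

      start : ∀ i → S i ≡ vertex (t + base i)
      start i = begin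
        S i                               ≡⟨ vertex-toℕ (S i) ⟨
        vertex (toℕ (S i))                ≡⟨ vertex-+*N (toℕ (S i)) t ⟨
        vertex (toℕ (S i) + t * N)        ≡⟨ cong vertex (regroup (toℕ (S i)) t n') ⟩
        vertex (t + base i)               ∎
        where
          open ≡-Reasoning
          regroup : ∀ u t n' → u + t * suc n' ≡ t + (u + t * n')
          regroup = solve-∀

      near : ∀ r → ∃₂ λ i (j : Fin (suc (2 * t))) → r ≡ vertex (toℕ j + base i)
      near r with i , reach ← win⇒reach t S r (capture r)
             with j , j≤2t , r≡ ← reach⇒near t (base i) (subst (λ u → Reach t u r) (start i) reach)
        = i , fromℕ< (s≤s j≤2t) ,
          trans r≡ (cong (λ j → vertex (j + base i)) (sym (toℕ-fromℕ< (s≤s j≤2t))))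

      code : Fin N → Fin (k * suc (2 * t))
      code r = combine (proj₁ (near r)) (proj₁ (proj₂ (near r)))

      code-injective : Injective _≡_ _≡_ code
      code-injective {r} {r'} eq
        with i≡i' , j≡j' ← combine-injective _ _ _ _ eq
        = trans (proj₂ (proj₂ (near r)))
            (trans (cong₂ (λ i j → vertex (toℕ j + base i)) i≡i' j≡j')
                   (sym (proj₂ (proj₂ (near r')))))

  lone-cop-evades : 3 ≤ n' → ∀ t (c : Cops (Cycle N) 1) x → c fzero ≡ vertex x →
                    ¬ Win (Cycle N) t c (vertex (2 + x))
  lone-cop-evades 3≤n' zero c x cx (fzero , c≡r) =
    vertex-≢ x (s≤s z≤n) (s≤s (≤-trans (s≤s (s≤s z≤n)) 3≤n')) (trans (sym cx) c≡r)
  lone-cop-evades 3≤n' (suc t) c x cx (inj₁ caught) = lone-cop-evades 3≤n' zero c x cx caught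
  lone-cop-evades 3≤n' (suc t) c x cx (inj₂ (c' , step , respond)) =
    answer (move⇒step z (subst (λ u → Move (Cycle N) u (c' fzero)) cop-shift (step fzero))) respond
    where
      z : ℕ
      z = n' + x

      cop-shift : c fzero ≡ vertex (suc z)
      cop-shift = trans cx (sym (vertex-N+ x))
      robber-shift : vertex (2 + x) ≡ vertex (3 + z)
      robber-shift = trans (sym (vertex-N+ (2 + x))) (cong (vertex ∘ suc) (x∙yz≈y∙xz n' 2 x))

      not-caught : ∀ {δ} → δ ≤ 2 → vertex (δ + z) ≢ vertex (3 + z)
      not-caught z≤n             = vertex-≢ z (s≤s z≤n) (s≤s 3≤n')
      not-caught (s≤s z≤n)       = vertex-≢ (1 + z) (s≤s z≤n) (s≤s (≤-trans (s≤s (s≤s z≤n)) 3≤n'))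
      not-caught (s≤s (s≤s z≤n)) = vertex-≢ (2 + z) (s≤s z≤n) (s≤s (≤-trans (s≤s z≤n) 3≤n'))

      -- The robber copies the cop's move.
      answer : (∃ λ δ → δ ≤ 2 × c' fzero ≡ vertex (δ + z)) →
               ¬ RobberToMove t c' (vertex (2 + x))
      answer (δ , δ≤2 , c'≡) (inj₁ (fzero , c'≡r)) =
        not-caught δ≤2 (trans (sym c'≡) (trans c'≡r robber-shift))
      answer (δ , δ≤2 , c'≡) (inj₂ chase) = lone-cop-evades 3≤n' t c' (δ + z) c'≡
        (subst (Win (Cycle N) t c' ∘ vertex) (x∙yz≈y∙xz δ 2 z)
          (chase _ (subst (λ r → Move (Cycle N) r (vertex (δ + (2 + z)))) (sym robber-shift)
                     (step⇒move (2 + z) δ≤2))))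

  mutual
    -- Each round both cops step inwards, shrinking the arc by two.
    arc-capture : ∀ t {k} (c : Cops (Cycle N) k) {i j} → i ≢ j → ∀ {a L d} →
                  c i ≡ vertex a → c j ≡ vertex (L + a) → L ≤ suc (2 * t) → d ≤ L →
                  Win (Cycle N) t c (vertex (d + a))
    arc-capture t c {i} {j} i≢j ci cj L≤ d≤L with arcPoint d≤L
    ... | left-end  = caught⇒win t (i , ci)
    ... | right-end = caught⇒win t (j , cj)
    arc-capture zero    c i≢j ci cj (s≤s ()) _ | interior _
    arc-capture (suc t) c {i} {j} i≢j {a} ci cj L≤ _ | interior {d} {L} d≤L =
      inj₂ (c' , step , subst (RobberToMove t c' ∘ vertex) (+-suc d a)
                          (robber-trapped t c' i≢j c'i c'j (2+L≤1+2[1+t]⇒L≤1+2t L≤) d≤L))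
      where
        c' : Cops (Cycle N) _
        c' = updateAt (updateAt c i (const (vertex (suc a)))) j (const (vertex (L + suc a)))

        c'i : c' i ≡ vertex (suc a)
        c'i = trans (updateAt-minimal i j _ i≢j) (updateAt-updates i c)

        c'j : c' j ≡ vertex (L + suc a)
        c'j = updateAt-updates j _

        step : CopStep (Cycle N) c c'
        step = copStep-updateAt (copStep-updateAt (copStep-stay c)
                 (subst (λ u → Move (Cycle N) u _) (sym ci) (inj₂ (inj₁ (cycSucc-vertex a)))))
                 (subst₂ (Move (Cycle N)) (sym cj) (cong vertex (sym (+-suc L a)))
                   (inj₂ (inj₂ (cycSucc-vertex (suc (L + a))))))

    robber-trapped : ∀ t {k} (c : Cops (Cycle N) k) {i j} → i ≢ j → ∀ {a L d} →
                     c i ≡ vertex a → c j ≡ vertex (L + a) → L ≤ suc (2 * t) → d ≤ L →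
                     RobberToMove t c (vertex (d + a))
    robber-trapped t c {i} {j} i≢j ci cj L≤ d≤L with arcPoint d≤L
    ... | left-end  = inj₁ (i , ci)
    ... | right-end = inj₁ (j , cj)
    robber-trapped t c i≢j {a} ci cj L≤ _ | interior {d} d≤L = inj₂ λ r move →
      let δ , δ≤2 , r≡ = move⇒step (d + a) move in
      subst (Win (Cycle N) t c) (trans (cong vertex (+-assoc δ d a)) (sym r≡))
        (arc-capture t c i≢j ci cj L≤ (+-mono-≤ δ≤2 d≤L))

  between-capture : ∀ t {k} (c : Cops (Cycle N) k) {i j} → i ≢ j → ∀ {a L x} →
                    c i ≡ vertex a → c j ≡ vertex (L + a) → L ≤ suc (2 * t) →
                    a ≤ x → x ≤ L + a → Win (Cycle N) t c (vertex x)
  between-capture t c i≢j {a} {L} {x} ci cj L≤ a≤x x≤L+a =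
    subst (Win (Cycle N) t c ∘ vertex) (m∸n+n≡m a≤x)
      (arc-capture t c i≢j ci cj L≤ (subst (x ∸ a ≤_) (m+n∸n≡m L a) (∸-monoˡ-≤ a x≤L+a)))

  vertex-N : vertex N ≡ vertex 0
  vertex-N = trans (cong vertex (sym (+-identityʳ N))) (vertex-N+ 0)

  vertex-<-≢ : ∀ {x y} → x < y → y < N → vertex x ≢ vertex y
  vertex-<-≢ x<y y<N eq = <-irrefl (vertex-injective-< (<-trans x<y y<N) y<N eq) x<y

  twoCops : ℕ → Cops (Cycle N) 2
  twoCops g = vertex ∘ (0 ∷ g ∷ [])

  twoCops-injective : ∀ {g} → 0 < g → g < N → Injective _≡_ _≡_ (twoCops g)
  twoCops-injective 0<g g<N {fzero}      {fzero}      _  = refl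
  twoCops-injective 0<g g<N {fzero}      {fsuc fzero} eq = ⊥-elim (vertex-<-≢ 0<g g<N eq)
  twoCops-injective 0<g g<N {fsuc fzero} {fzero}      eq = ⊥-elim (vertex-<-≢ 0<g g<N (sym eq))
  twoCops-injective 0<g g<N {fsuc fzero} {fsuc fzero} _  = refl

  twoCops-capture : ∀ {g₁ g₂ t} → g₂ + g₁ ≡ N → g₁ ≤ suc (2 * t) → g₂ ≤ suc (2 * t) →
                    CapturesWithin (Cycle N) (twoCops g₁) t
  twoCops-capture {g₁} {g₂} {t} N≡ g₁≤ g₂≤ r =
    subst (Win (Cycle N) t (twoCops g₁)) (vertex-toℕ r) (capture-at (toℕ r) (toℕ<n r))
    where
      capture-at : ∀ x → x < N → Win (Cycle N) t (twoCops g₁) (vertex x)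
      capture-at x x<N with ≤-total x g₁
      ... | inj₁ x≤g₁ = between-capture t (twoCops g₁) {fzero} {fsuc fzero} (λ ()) refl
                          (cong vertex (sym (+-identityʳ g₁))) g₁≤ z≤n
                          (subst (x ≤_) (sym (+-identityʳ g₁)) x≤g₁)
      ... | inj₂ g₁≤x = between-capture t (twoCops g₁) {fsuc fzero} {fzero} (λ ()) refl
                          (sym (trans (cong vertex N≡) vertex-N)) g₂≤ g₁≤x
                          (<⇒≤ (subst (x <_) (sym N≡) x<N))

  threeCops : ℕ → ℕ → Cops (Cycle N) 3
  threeCops g₁ g₂ = vertex ∘ (0 ∷ g₁ ∷ g₂ + g₁ ∷ [])

  threeCops-injective : ∀ {g₁ g₂} → 0 < g₁ → 0 < g₂ → g₂ + g₁ < N →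
                        Injective _≡_ _≡_ (threeCops g₁ g₂)
  threeCops-injective {g₁} {g₂} 0<g₁ 0<g₂ g₂+g₁<N = injective
    where
      g₁<g₂+g₁ : g₁ < g₂ + g₁
      g₁<g₂+g₁ = m<n+m g₁ 0<g₂
      0<g₂+g₁ : 0 < g₂ + g₁
      0<g₂+g₁ = <-trans 0<g₁ g₁<g₂+g₁
      g₁<N : g₁ < N
      g₁<N = <-trans g₁<g₂+g₁ g₂+g₁<N

      injective : Injective _≡_ _≡_ (threeCops g₁ g₂)
      injective {fzero}             {fzero}             _  = refl
      injective {fsuc fzero}        {fsuc fzero}        _  = refl
      injective {fsuc (fsuc fzero)} {fsuc (fsuc fzero)} _  = refl
      injective {fzero}             {fsuc fzero}        eq = ⊥-elim (vertex-<-≢ 0<g₁ g₁<N eq)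
      injective {fsuc fzero}        {fzero}             eq = ⊥-elim (vertex-<-≢ 0<g₁ g₁<N (sym eq))
      injective {fzero}             {fsuc (fsuc fzero)} eq = ⊥-elim (vertex-<-≢ 0<g₂+g₁ g₂+g₁<N eq)
      injective {fsuc (fsuc fzero)} {fzero}             eq =
        ⊥-elim (vertex-<-≢ 0<g₂+g₁ g₂+g₁<N (sym eq))
      injective {fsuc fzero}        {fsuc (fsuc fzero)} eq = ⊥-elim (vertex-<-≢ g₁<g₂+g₁ g₂+g₁<N eq)
      injective {fsuc (fsuc fzero)} {fsuc fzero}        eq =
        ⊥-elim (vertex-<-≢ g₁<g₂+g₁ g₂+g₁<N (sym eq))

  threeCops-capture : ∀ {g₁ g₂ g₃ t} → g₃ + (g₂ + g₁) ≡ N →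
                      g₁ ≤ suc (2 * t) → g₂ ≤ suc (2 * t) → g₃ ≤ suc (2 * t) →
                      CapturesWithin (Cycle N) (threeCops g₁ g₂) t
  threeCops-capture {g₁} {g₂} {g₃} {t} N≡ g₁≤ g₂≤ g₃≤ r =
    subst (Win (Cycle N) t (threeCops g₁ g₂)) (vertex-toℕ r) (capture-at (toℕ r) (toℕ<n r))
    where
      capture-at : ∀ x → x < N → Win (Cycle N) t (threeCops g₁ g₂) (vertex x)
      capture-at x x<N with ≤-total x g₁ | ≤-total x (g₂ + g₁)
      ... | inj₁ x≤g₁ | _ = between-capture t (threeCops g₁ g₂) {fzero} {fsuc fzero} (λ ()) refl
                              (cong vertex (sym (+-identityʳ g₁))) g₁≤ z≤n
                              (subst (x ≤_) (sym (+-identityʳ g₁)) x≤g₁)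
      ... | inj₂ g₁≤x | inj₁ x≤g₂+g₁ =
        between-capture t (threeCops g₁ g₂) {fsuc fzero} {fsuc (fsuc fzero)} (λ ()) refl refl
          g₂≤ g₁≤x x≤g₂+g₁
      ... | inj₂ _ | inj₂ g₂+g₁≤x =
        between-capture t (threeCops g₁ g₂) {fsuc (fsuc fzero)} {fzero} (λ ()) refl
          (sym (trans (cong vertex N≡) vertex-N)) g₃≤ g₂+g₁≤x
          (<⇒≤ (subst (x <_) (sym N≡) x<N))

  isCopNumber-2 : 3 ≤ n' → IsCopNumber (Cycle N) 2
  isCopNumber-2 3≤n' =
    ((twoCops 1 , twoCops-injective (s≤s z≤n) (s≤s (≤-trans (s≤s z≤n) 3≤n'))) ,
     n' , twoCops-capture (+-comm n' 1) (s≤s z≤n) (m≤n⇒m≤1+n (m≤m+n n' (n' + 0)))) ,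
    λ where
      zero    S t capture → case capturesWithin⇒N≤k*[1+2t] (proj₁ S) t capture of λ ()
      (suc zero) (S , _) t capture →
        ⊥-elim (lone-cop-evades 3≤n' t S (toℕ (S fzero)) (sym (vertex-toℕ (S fzero))) (capture _))
      (suc (suc k)) _ _ _ → s≤s (s≤s z≤n)

  isThrottlingNumber-cycle :
    3 ≤ n' → ∀ {k t m} → 2 ≤ k →
    (S : InitialSet (Cycle N) k) → CapturesWithin (Cycle N) (proj₁ S) t →
    (∀ t' → N ≤ k * suc (2 * t') → t ≤ t') → m ≡ k * (1 + t) →
    (∀ k' t' → 2 ≤ k' → N ≤ k' * suc (2 * t') → m ≤ k' * (1 + t')) →
    IsThrottlingNumber (Cycle N) m
  isThrottlingNumber-cycle 3≤n' =
    isThrottlingNumber-intro (λ k t → N ≤ k * suc (2 * t)) capturesWithin⇒N≤k*[1+2t]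
      (isCopNumber-2 3≤n')

  throttling-normal : 3 ≤ n' → ¬ Exceptional N →
                      IsThrottlingNumber (Cycle N) (2 * (1 + ⌈ N ∸ 2 / 4 ⌉))
  throttling-normal 3≤n' regular =
    isThrottlingNumber-cycle 3≤n' ≤-refl
      (twoCops g , twoCops-injective (s≤s z≤n) 2+2T≤N)
      (twoCops-capture (m∸n+n≡m (<⇒≤ 2+2T≤N)) ≤-refl gap≤)
      (λ _ → T≤t) refl (λ _ _ → 2*[1+T]≤k*[1+t] regular)
    where
      T : ℕ
      T = ⌈ N ∸ 2 / 4 ⌉

      g : ℕ
      g = suc (2 * T)

      N∸2+2≡N : N ∸ 2 + 2 ≡ N
      N∸2+2≡N = m∸n+n≡m (≤-trans (s≤s (s≤s z≤n)) (s≤s 3≤n'))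

      T*4≤N+1 : T * 4 ≤ N + 1
      T*4≤N+1 = ≤-trans (⌈a/1+b⌉*[1+b]≤a+b (N ∸ 2) 3)
                  (≤-reflexive (trans (sym (+-assoc (N ∸ 2) 2 1)) (cong (_+ 1) N∸2+2≡N)))

      open NormalCase {T = T} (s≤s 3≤n') T*4≤N+1

      gap≤ : N ∸ g ≤ g
      gap≤ = m≤n+o⇒m∸n≤o N g (begin
        N             ≡⟨ N∸2+2≡N ⟨
        N ∸ 2 + 2     ≤⟨ +-monoˡ-≤ 2 (a≤⌈a/1+b⌉*[1+b] (N ∸ 2) 3) ⟩
        T * 4 + 2     ≡⟨ e T ⟩
        g + g         ∎)
        where
          open ≤-Reasoning
          e : ∀ T → T * 4 + 2 ≡ suc (2 * T) + suc (2 * T)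
          e = solve-∀

  throttling-exceptional : 3 ≤ n' → ∀ {i} → N ≡ 12 * i + 3 →
                           IsThrottlingNumber (Cycle N) (3 * (1 + ⌈ N ∸ 3 / 6 ⌉))
  throttling-exceptional 3≤n' {i} N≡12i+3 =
    subst (λ q → IsThrottlingNumber (Cycle N) (3 * (1 + q))) (sym ⌈N∸3/6⌉≡2i)
      (isThrottlingNumber-cycle 3≤n' (s≤s (s≤s z≤n))
        (threeCops g g , threeCops-injective (s≤s z≤n) (s≤s z≤n) g+g<N)
        (threeCops-capture 3g≡N ≤-refl ≤-refl ≤-refl)
        (λ _ → 2i≤t) refl (λ _ _ → 3*[1+2i]≤k*[1+t]))
    where
      open ExceptionalCase {i = i} N≡12i+3
      g : ℕ
      g = suc (2 * (2 * i))

      3g≡N : g + (g + g) ≡ N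
      3g≡N = trans (e i) (sym N≡12i+3)
        where
          e : ∀ i → suc (2 * (2 * i)) + (suc (2 * (2 * i)) + suc (2 * (2 * i))) ≡ 12 * i + 3
          e = solve-∀

      g+g<N : g + g < N
      g+g<N = ≤-trans (m≤m+n (suc (g + g)) (4 * i)) (≤-reflexive (trans (e i) (sym N≡12i+3)))
        where
          e : ∀ i → suc (suc (2 * (2 * i)) + suc (2 * (2 * i))) + 4 * i ≡ 12 * i + 3
          e = solve-∀

mainTheorem12 : ∀ (n : ℕ) → 4 ≤ n →
    ((Σ ℕ λ i → 1 ≤ i × n ≡ 12 * i + 3) →
      IsThrottlingNumber (Cycle n) (3 * (1 + ⌈ n ∸ 3 / 6 ⌉))) ×
    (¬ (Σ ℕ λ i → 1 ≤ i × n ≡ 12 * i + 3) →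
      IsThrottlingNumber (Cycle n) (2 * (1 + ⌈ n ∸ 2 / 4 ⌉)))
mainTheorem12 n 4≤n with e , refl ← m≤n⇒∃[o]m+o≡n 4≤n =
  (λ (i , _ , n≡12i+3) → throttling-exceptional 3≤3+e {i} n≡12i+3) , throttling-normal 3≤3+e
  where
    open OnCycle (3 + e)
    3≤3+e : 3 ≤ 3 + e
    3≤3+e = m≤m+n 3 e
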